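{- Let $p$ be a prime, $d,k$ positive integers, $\mathbf N^{(1)},\dots,\mathbf N^{(k)}\in\mathbb{Z}^d$ with $\mathbf N^{(j)}\ge\mathbf 0$. For all non-negative integers $s$, all $\mathbf n\in\mathbb{Z}^d$ with $\mathbf n\ge\mathbf 0$, and all $\mathbf u\in\mathbb{Z}^d$ with $0\le u_i<p^s$ for $i=1,\dots,d$, $$\frac{B_{\mathbf N}(\mathbf u+\mathbf n p^s)}{B_{\mathbf N}(\mathbf u)}\in B_{\mathbf N}(\mathbf n)\mathbb{Z}_p.$$
   Context: For $\mathbf P,\mathbf m\in\mathbb{Z}^d$ with $\mathbf P,\mathbf m\ge\mathbf 0$, $B(\mathbf P,\mathbf m)=\big(\sum_{i=1}^dP_im_i\big)!\big/\prod_{i=1}^dm_i!^{P_i}$, and $B_{\mathbf N}(\mathbf m)=\prod_{j=1}^kB(\mathbf N^{(j)},\mathbf m)$. Vector inequalities are componentwise. $\mathbb{Z}_p$ denotes the $p$-adic integers. -}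

module Defs where

open import Data.Nat.Base using (ℕ; zero; suc; _+_; _*_; _^_; _!)
open import Data.Nat.Divisibility using (_∣_)
open import Data.Fin.Base using (Fin; zero; suc)
open import Data.Product using (_×_; _,_; proj₁; proj₂; ∃-syntax)
open import Relation.Nullary using (¬_)
open import Relation.Binary.PropositionalEquality using (_≡_)

sumF : ∀ {d} → (Fin d → ℕ) → ℕ
sumF {zero}  f = 0
sumF {suc d} f = f zero + sumF (λ i → f (suc i))

prodF : ∀ {d} → (Fin d → ℕ) → ℕ
prodF {zero}  f = 1
prodF {suc d} f = f zero * prodF (λ i → f (suc i))

-- a positive rational represented as (numerator , denominator)
Frac : Set
Frac = ℕ × ℕ

divF : Frac → Frac → Frac
divF (a , b) (c , e) = (a * e , b * c)

B : ∀ {d} → (Fin d → ℕ) → (Fin d → ℕ) → Frac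
B P m = (sumF (λ i → P i * m i)) ! , prodF (λ i → (m i !) ^ P i)

BN : ∀ {d k} → (Fin k → Fin d → ℕ) → (Fin d → ℕ) → Frac
BN N m = prodF (λ j → proj₁ (B (N j) m)) , prodF (λ j → proj₂ (B (N j) m))

-- x ∈ y ℤ_p for positive rationals x = a/b, y = c/e :
-- x / y = (a e)/(b c) lies in ℤ_p ∩ ℚ = ℤ_(p), i.e. equals c'/e' with p ∤ e'.
InMulZp : ℕ → Frac → Frac → Set
InMulZp p (a , b) (c , e) =
  ∃[ c' ] ∃[ e' ] (¬ (p ∣ e') × (a * e) * e' ≡ c' * (b * c))

-- The p-adic valuation of m! is Legendre's sum L(m) = ⌊m/p⌋ + ⌊m/p²⌋ + ⋯, which satisfies
-- L(m) = ⌊m/p⌋ + L(⌊m/p⌋). From this recursion L is superadditive, and for u < p^s the base-p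
-- digits of u and of n p^s do not interact, so L(u + n p^s) = L(u) + L(n) + n(1 + p + ⋯ + p^(s-1)).
-- Writing M = u + n p^s, the denominator Π (M_i!)^(P_i) of B(P, M) therefore has valuation exactly
-- that of the denominators of B(P, u) and B(P, n) plus (Σ P_i n_i)(1 + ⋯ + p^(s-1)), while by
-- superadditivity the numerator (Σ P_i M_i)! has at least the corresponding valuation. Hence
-- v_p(B(P, M)) ≥ v_p(B(P, u)) + v_p(B(P, n)) for every P, and taking the product over j gives the claim.
module Submission where

open import Data.Empty using (⊥-elim)
open import Data.Fin.Base using (Fin; zero; suc)
open import Data.Nat.Base
open import Data.Nat.Divisibility using (_∤_; divides; _∣?_; ∣1⇒≡1)
open import Data.Nat.DivMod
open import Data.Nat.Induction using (<-rec)
open import Data.Nat.Primality using (Prime; prime⇒nonTrivial; euclidsLemma)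
open import Data.Nat.Properties
open import Data.Nat.Tactic.RingSolver using (solve-∀)
open import Data.Product using (_×_; _,_; proj₁; proj₂; ∃-syntax)
open import Data.Sum using (inj₁; inj₂; [_,_])
open import Function.Base using (_∘_)
open import Relation.Nullary using (yes; no)
open import Relation.Binary.PropositionalEquality hiding ([_])
open import Algebra.Properties.CommutativeSemigroup +-commutativeSemigroup
  using () renaming (interchange to +-interchange)

open import Defs

sumF-cong : ∀ {d} {f g : Fin d → ℕ} → (∀ i → f i ≡ g i) → sumF f ≡ sumF g
sumF-cong {zero}  f≗g = refl
sumF-cong {suc d} f≗g = cong₂ _+_ (f≗g zero) (sumF-cong (λ i → f≗g (suc i)))

sumF-+ : ∀ {d} (f g : Fin d → ℕ) → sumF (λ i → f i + g i) ≡ sumF f + sumF g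
sumF-+ {zero}  f g = refl
sumF-+ {suc d} f g = trans (cong (f zero + g zero +_) (sumF-+ (λ i → f (suc i)) (λ i → g (suc i))))
                           (+-interchange (f zero) (g zero) _ _)

sumF-*ʳ : ∀ {d} (f : Fin d → ℕ) c → sumF (λ i → f i * c) ≡ sumF f * c
sumF-*ʳ {zero}  f c = refl
sumF-*ʳ {suc d} f c = trans (cong (f zero * c +_) (sumF-*ʳ (λ i → f (suc i)) c))
                            (sym (*-distribʳ-+ c (f zero) _))

sumF-mono-≤ : ∀ {d} {f g : Fin d → ℕ} → (∀ i → f i ≤ g i) → sumF f ≤ sumF g
sumF-mono-≤ {zero}  f≤g = ≤-refl
sumF-mono-≤ {suc d} f≤g = +-mono-≤ (f≤g zero) (sumF-mono-≤ (λ i → f≤g (suc i)))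

weightedSum : ∀ {d} → (Fin d → ℕ) → (Fin d → ℕ) → ℕ
weightedSum P m = sumF (λ i → P i * m i)

weightedSum-+* : ∀ {d} (P u n : Fin d → ℕ) c →
                 weightedSum P (λ i → u i + n i * c) ≡ weightedSum P u + weightedSum P n * c
weightedSum-+* P u n c = begin
  sumF (λ i → P i * (u i + n i * c))             ≡⟨ sumF-cong (λ i → distrib (P i) (u i) (n i)) ⟩
  sumF (λ i → P i * u i + P i * n i * c)         ≡⟨ sumF-+ (λ i → P i * u i) (λ i → P i * n i * c) ⟩
  weightedSum P u + sumF (λ i → P i * n i * c)   ≡⟨ cong (weightedSum P u +_) (sumF-*ʳ (λ i → P i * n i) c) ⟩
  weightedSum P u + weightedSum P n * c          ∎
  where
  open ≡-Reasoning
  distrib : ∀ x y z → x * (y + z * c) ≡ x * y + x * z * c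
  distrib x y z = trans (*-distribˡ-+ x y (z * c)) (cong (x * y +_) (sym (*-assoc x z c)))

[r+q*n]/n≡q : ∀ {n} .{{_ : NonZero n}} q {r} → r < n → (r + q * n) / n ≡ q
[r+q*n]/n≡q {n} q {r} r<n = begin
  (r + q * n) / n  ≡⟨ +-distrib-/-∣ʳ r (divides q refl) ⟩
  r / n + q * n / n ≡⟨ cong₂ _+_ (m<n⇒m/n≡0 r<n) (m*n/n≡m q n) ⟩
  q                ∎
  where open ≡-Reasoning

n∤1+m⇒[1+m]/n≡m/n : ∀ {m n} .{{_ : NonZero n}} → n ∤ suc m → suc m / n ≡ m / n
n∤1+m⇒[1+m]/n≡m/n {m} {n} n∤1+m with m≤n⇒m<n∨m≡n (m%n<n m n)
... | inj₁ 1+r<n = trans (cong (λ x → suc x / n) (m≡m%n+[m/n]*n m n)) ([r+q*n]/n≡q (m / n) 1+r<n)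
... | inj₂ 1+r≡n = ⊥-elim (n∤1+m (divides (suc (m / n))
        (trans (cong suc (m≡m%n+[m/n]*n m n)) (cong (_+ m / n * n) 1+r≡n))))

m/o+n/o≤[m+n]/o : ∀ m n o .{{_ : NonZero o}} → m / o + n / o ≤ (m + n) / o
m/o+n/o≤[m+n]/o m n o = begin
  m / o + n / o           ≡⟨ m*n/n≡m (m / o + n / o) o ⟨
  (m / o + n / o) * o / o ≤⟨ /-monoˡ-≤ o (begin
      (m / o + n / o) * o   ≡⟨ *-distribʳ-+ o (m / o) (n / o) ⟩
      m / o * o + n / o * o ≤⟨ +-mono-≤ (m/n*n≤m m o) (m/n*n≤m n o) ⟩
      m + n                 ∎) ⟩
  (m + n) / o             ∎
  where open ≤-Reasoning

module Legendre (p : ℕ) .{{_ : NonTrivial p}} where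

  instance
    p≢0 : NonZero p
    p≢0 = nonTrivial⇒nonZero p

  1<p : 1 < p
  1<p = nonTrivial⇒n>1 p

  -- The fuel only has to exceed the number of digits of x in base p; x itself always does.
  legendreFuel : ℕ → ℕ → ℕ
  legendreFuel zero    x = 0
  legendreFuel (suc f) x = x / p + legendreFuel f (x / p)

  legendre : ℕ → ℕ
  legendre x = legendreFuel x x

  private
    /p≤pred : ∀ {f x} → x ≤ suc f → x / p ≤ f
    /p≤pred {f} {zero}  _     = subst (_≤ f) (sym (0/n≡0 p)) z≤n
    /p≤pred {f} {suc x} x≤1+f = s≤s⁻¹ (≤-trans (m/n<m (suc x) p 1<p) x≤1+f)

    legendreFuel-suc : ∀ {f x} → x ≤ f → legendreFuel (suc f) x ≡ legendreFuel f x
    legendreFuel-suc {zero}  x≤0   rewrite n≤0⇒n≡0 x≤0 = trans (+-identityʳ (0 / p)) (0/n≡0 p)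
    legendreFuel-suc {suc f} {x} x≤1+f = cong (x / p +_) (legendreFuel-suc (/p≤pred x≤1+f))

    legendreFuel-enough : ∀ {f x} → x ≤ f → legendreFuel f x ≡ legendre x
    legendreFuel-enough x≤f with m≤n⇒m<n∨m≡n x≤f
    ... | inj₂ refl        = refl
    ... | inj₁ (s≤s x≤f′) = trans (legendreFuel-suc x≤f′) (legendreFuel-enough x≤f′)

  legendre-unfold : ∀ x → legendre x ≡ x / p + legendre (x / p)
  legendre-unfold zero    = sym (cong (λ y → y + legendre y) (0/n≡0 p))
  legendre-unfold (suc x) = cong (suc x / p +_) (legendreFuel-enough (/p≤pred ≤-refl))

  legendre-*p : ∀ x → legendre (x * p) ≡ x + legendre x
  legendre-*p x = trans (legendre-unfold (x * p)) (cong (λ y → y + legendre y) (m*n/n≡m x p))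

  legendre-+-≤ : ∀ c a b → a + b ≤ c → legendre a + legendre b ≤ legendre c
  legendre-+-≤ = <-rec _ step
    where
    open ≤-Reasoning
    step : ∀ c → (∀ {c′} → c′ < c → ∀ a b → a + b ≤ c′ → legendre a + legendre b ≤ legendre c′) →
           ∀ a b → a + b ≤ c → legendre a + legendre b ≤ legendre c
    step zero      _   zero zero _     = ≤-refl
    step c@(suc _) rec a    b    a+b≤c = begin
      legendre a + legendre b
        ≡⟨ cong₂ _+_ (legendre-unfold a) (legendre-unfold b) ⟩
      (a / p + legendre (a / p)) + (b / p + legendre (b / p))
        ≡⟨ +-interchange (a / p) _ (b / p) _ ⟩
      (a / p + b / p) + (legendre (a / p) + legendre (b / p))
        ≤⟨ +-mono-≤ digits (rec (m/n<m c p 1<p) (a / p) (b / p) digits) ⟩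
      c / p + legendre (c / p)
        ≡⟨ legendre-unfold c ⟨
      legendre c ∎
      where
      digits : a / p + b / p ≤ c / p
      digits = ≤-trans (m/o+n/o≤[m+n]/o a b p) (/-monoˡ-≤ p a+b≤c)

  legendre-superadditive : ∀ a b → legendre a + legendre b ≤ legendre (a + b)
  legendre-superadditive a b = legendre-+-≤ (a + b) a b ≤-refl

  geometricSum : ℕ → ℕ
  geometricSum zero    = 0
  geometricSum (suc s) = p ^ s + geometricSum s

  private
    [x+n*p^[1+s]]/p : ∀ s x n → (x + n * p ^ suc s) / p ≡ x / p + n * p ^ s
    [x+n*p^[1+s]]/p s x n = begin
      (x + n * (p * p ^ s)) / p ≡⟨ cong (λ y → (x + y) / p) (rearrange n) ⟩
      (x + n * p ^ s * p) / p   ≡⟨ +-distrib-/-∣ʳ x {n * p ^ s * p} (divides (n * p ^ s) refl) ⟩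
      x / p + n * p ^ s * p / p ≡⟨ cong (x / p +_) (m*n/n≡m (n * p ^ s) p) ⟩
      x / p + n * p ^ s         ∎
      where
      open ≡-Reasoning
      rearrange : ∀ n → n * (p * p ^ s) ≡ n * p ^ s * p
      rearrange n = trans (cong (n *_) (*-comm p (p ^ s))) (sym (*-assoc n (p ^ s) p))

  legendre-+*p^ : ∀ s {x} n → x < p ^ s →
                  legendre (x + n * p ^ s) ≡ legendre x + legendre n + n * geometricSum s
  legendre-+*p^ zero    {zero} n _ = begin
    legendre (n * 1)    ≡⟨ cong legendre (*-identityʳ n) ⟩
    legendre n          ≡⟨ +-identityʳ (legendre n) ⟨
    legendre n + 0      ≡⟨ cong (legendre n +_) (*-zeroʳ n) ⟨
    legendre n + n * 0  ∎
    where open ≡-Reasoning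
  legendre-+*p^ zero    {suc x} n (s≤s ())
  legendre-+*p^ (suc s) {x} n x<p^[1+s] = begin
    legendre (x + n * p ^ suc s)
      ≡⟨ legendre-unfold _ ⟩
    (x + n * p ^ suc s) / p + legendre ((x + n * p ^ suc s) / p)
      ≡⟨ cong (λ y → y + legendre y) ([x+n*p^[1+s]]/p s x n) ⟩
    (x / p + n * p ^ s) + legendre (x / p + n * p ^ s)
      ≡⟨ cong (x / p + n * p ^ s +_) (legendre-+*p^ s n x/p<p^s) ⟩
    (x / p + n * p ^ s) + (legendre (x / p) + legendre n + n * geometricSum s)
      ≡⟨ rearrange (x / p) (legendre (x / p)) (legendre n) n (p ^ s) (geometricSum s) ⟩
    (x / p + legendre (x / p)) + legendre n + n * geometricSum (suc s)
      ≡⟨ cong (λ y → y + legendre n + n * geometricSum (suc s)) (legendre-unfold x) ⟨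
    legendre x + legendre n + n * geometricSum (suc s) ∎
    where
    open ≡-Reasoning
    x/p<p^s : x / p < p ^ s
    x/p<p^s = m<n*o⇒m/o<n (subst (x <_) (*-comm p (p ^ s)) x<p^[1+s])
    rearrange : ∀ a La Ln n q g → (a + n * q) + (La + Ln + n * g) ≡ (a + La) + Ln + n * (q + g)
    rearrange = solve-∀

  legendre-+*p^-≥ : ∀ s x n → legendre x + legendre n + n * geometricSum s ≤ legendre (x + n * p ^ s)
  legendre-+*p^-≥ s x n = begin
    legendre x + legendre n + n * geometricSum s   ≡⟨ +-assoc (legendre x) _ _ ⟩
    legendre x + (legendre n + n * geometricSum s) ≡⟨ cong (legendre x +_) (legendre-+*p^ s n (m^n>0 p s)) ⟨
    legendre x + legendre (n * p ^ s)              ≤⟨ legendre-superadditive x (n * p ^ s) ⟩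
    legendre (x + n * p ^ s)                       ∎
    where open ≤-Reasoning

  weightedLegendre : ∀ {d} → (Fin d → ℕ) → (Fin d → ℕ) → ℕ
  weightedLegendre P m = sumF (λ i → P i * legendre (m i))

  weightedLegendre-+*p^ : ∀ {d} (P : Fin d → ℕ) s (n u : Fin d → ℕ) → (∀ i → u i < p ^ s) →
    weightedLegendre P (λ i → u i + n i * p ^ s) ≡
    weightedLegendre P u + weightedLegendre P n + weightedSum P n * geometricSum s
  weightedLegendre-+*p^ P s n u u<p^s = begin
    sumF (λ i → P i * legendre (u i + n i * p ^ s))
      ≡⟨ sumF-cong (λ i → trans (cong (P i *_) (legendre-+*p^ s (n i) (u<p^s i)))
                                (distrib (P i) (legendre (u i)) (legendre (n i)) (n i) (geometricSum s))) ⟩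
    sumF (λ i → (P i * legendre (u i) + P i * legendre (n i)) + P i * n i * geometricSum s)
      ≡⟨ sumF-+ (λ i → P i * legendre (u i) + P i * legendre (n i)) (λ i → P i * n i * geometricSum s) ⟩
    sumF (λ i → P i * legendre (u i) + P i * legendre (n i)) + sumF (λ i → P i * n i * geometricSum s)
      ≡⟨ cong₂ _+_ (sumF-+ (λ i → P i * legendre (u i)) (λ i → P i * legendre (n i)))
                   (sumF-*ʳ (λ i → P i * n i) (geometricSum s)) ⟩
    weightedLegendre P u + weightedLegendre P n + weightedSum P n * geometricSum s ∎
    where
    open ≡-Reasoning
    distrib : ∀ x Lu Ln n g → x * (Lu + Ln + n * g) ≡ (x * Lu + x * Ln) + x * n * g
    distrib = solve-∀

  -- v_p(B(P, u + n p^s)) ≥ v_p(B(P, u)) + v_p(B(P, n)), with the denominators moved across.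
  legendre-B-+*p^ : ∀ {d} (P : Fin d → ℕ) s (n u : Fin d → ℕ) → (∀ i → u i < p ^ s) →
    let M = λ i → u i + n i * p ^ s in
    weightedLegendre P M + legendre (weightedSum P u) + legendre (weightedSum P n) ≤
    legendre (weightedSum P M) + weightedLegendre P u + weightedLegendre P n
  legendre-B-+*p^ P s n u u<p^s = begin
    weightedLegendre P M + Lu + Ln
      ≡⟨ cong (λ y → y + Lu + Ln) (weightedLegendre-+*p^ P s n u u<p^s) ⟩
    WLu + WLn + weightedSum P n * geometricSum s + Lu + Ln
      ≡⟨ rearrange WLu WLn (weightedSum P n * geometricSum s) Lu Ln ⟩
    Lu + Ln + weightedSum P n * geometricSum s + (WLu + WLn)
      ≤⟨ +-monoˡ-≤ (WLu + WLn) (legendre-+*p^-≥ s (weightedSum P u) (weightedSum P n)) ⟩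
    legendre (weightedSum P u + weightedSum P n * p ^ s) + (WLu + WLn)
      ≡⟨ cong (λ y → legendre y + (WLu + WLn)) (weightedSum-+* P u n (p ^ s)) ⟨
    legendre (weightedSum P M) + (WLu + WLn)
      ≡⟨ +-assoc (legendre (weightedSum P M)) WLu WLn ⟨
    legendre (weightedSum P M) + WLu + WLn ∎
    where
    open ≤-Reasoning
    M : Fin _ → ℕ
    M i = u i + n i * p ^ s
    Lu Ln WLu WLn : ℕ
    Lu = legendre (weightedSum P u)
    Ln = legendre (weightedSum P n)
    WLu = weightedLegendre P u
    WLn = weightedLegendre P n
    rearrange : ∀ a b c x y → a + b + c + x + y ≡ x + y + c + (a + b)
    rearrange = solve-∀

  legendreNumBN legendreDenBN : ∀ {d k} → (Fin k → Fin d → ℕ) → (Fin d → ℕ) → ℕ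
  legendreNumBN N m = sumF (λ j → legendre (weightedSum (N j) m))
  legendreDenBN N m = sumF (λ j → weightedLegendre (N j) m)

  legendre-BN-+*p^ : ∀ {d k} (N : Fin k → Fin d → ℕ) s (n u : Fin d → ℕ) → (∀ i → u i < p ^ s) →
    let M = λ i → u i + n i * p ^ s in
    legendreDenBN N M + legendreNumBN N u + legendreNumBN N n ≤
    legendreNumBN N M + legendreDenBN N u + legendreDenBN N n
  legendre-BN-+*p^ N s n u u<p^s = begin
    sumF (λ j → weightedLegendre (N j) M) + sumF (λ j → legendre (weightedSum (N j) u))
      + sumF (λ j → legendre (weightedSum (N j) n))
      ≡⟨ sumF-+₃ (λ j → weightedLegendre (N j) M) (λ j → legendre (weightedSum (N j) u))
                 (λ j → legendre (weightedSum (N j) n)) ⟨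
    sumF (λ j → weightedLegendre (N j) M + legendre (weightedSum (N j) u) + legendre (weightedSum (N j) n))
      ≤⟨ sumF-mono-≤ (λ j → legendre-B-+*p^ (N j) s n u u<p^s) ⟩
    sumF (λ j → legendre (weightedSum (N j) M) + weightedLegendre (N j) u + weightedLegendre (N j) n)
      ≡⟨ sumF-+₃ (λ j → legendre (weightedSum (N j) M)) (λ j → weightedLegendre (N j) u)
                 (λ j → weightedLegendre (N j) n) ⟩
    sumF (λ j → legendre (weightedSum (N j) M)) + sumF (λ j → weightedLegendre (N j) u)
      + sumF (λ j → weightedLegendre (N j) n) ∎
    where
    open ≤-Reasoning
    M : Fin _ → ℕ
    M i = u i + n i * p ^ s
    sumF-+₃ : ∀ {k} (f g h : Fin k → ℕ) → sumF (λ j → f j + g j + h j) ≡ sumF f + sumF g + sumF h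
    sumF-+₃ f g h = trans (sumF-+ (λ j → f j + g j) h) (cong (_+ sumF h) (sumF-+ f g))

module PAdicValuation (p : ℕ) (p-prime : Prime p) where

  open Legendre p {{prime⇒nonTrivial p-prime}}

  record Valuation (x e : ℕ) : Set where
    constructor valuation
    field
      cofactor      : ℕ
      factorisation : x ≡ p ^ e * cofactor
      p∤cofactor    : p ∤ cofactor

  valuation-p∤ : ∀ {x} → p ∤ x → Valuation x 0
  valuation-p∤ {x} p∤x = valuation x (sym (+-identityʳ x)) p∤x

  p∤1 : p ∤ 1
  p∤1 p∣1 = >⇒≢ 1<p (∣1⇒≡1 p∣1)

  valuation-1 : Valuation 1 0
  valuation-1 = valuation-p∤ p∤1

  valuation-p : Valuation p 1
  valuation-p = valuation 1 (sym (trans (*-identityʳ (p * 1)) (*-identityʳ p))) p∤1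

  valuation-* : ∀ {x y a b} → Valuation x a → Valuation y b → Valuation (x * y) (a + b)
  valuation-* {a = a} {b} (valuation r refl p∤r) (valuation t refl p∤t) =
    valuation (r * t)
      (trans ([m*n]*[o*p]≡[m*o]*[n*p] (p ^ a) r (p ^ b) t) (cong (_* (r * t)) (sym (^-distribˡ-+-* p a b))))
      ([ p∤r , p∤t ] ∘ euclidsLemma r t p-prime)

  valuation-^ : ∀ {x a} → Valuation x a → ∀ k → Valuation (x ^ k) (k * a)
  valuation-^ v zero    = valuation-1
  valuation-^ v (suc k) = valuation-* v (valuation-^ v k)

  valuation-prodF : ∀ {d} (f a : Fin d → ℕ) → (∀ i → Valuation (f i) (a i)) → Valuation (prodF f) (sumF a)
  valuation-prodF {zero}  f a v = valuation-1
  valuation-prodF {suc d} f a v =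
    valuation-* (v zero) (valuation-prodF (λ i → f (suc i)) (λ i → a (suc i)) (λ i → v (suc i)))

  legendre-suc : ∀ m → ∃[ w ] (Valuation (suc m) w × legendre (suc m) ≡ legendre m + w)
  legendre-suc = <-rec _ step
    where
    step : ∀ m → (∀ {y} → y < m → ∃[ w ] (Valuation (suc y) w × legendre (suc y) ≡ legendre y + w)) →
           ∃[ w ] (Valuation (suc m) w × legendre (suc m) ≡ legendre m + w)
    step m rec with p ∣? suc m
    ... | no p∤1+m = 0 , valuation-p∤ p∤1+m , (begin
      legendre (suc m)                     ≡⟨ legendre-unfold (suc m) ⟩
      suc m / p + legendre (suc m / p)     ≡⟨ cong (λ y → y + legendre y) (n∤1+m⇒[1+m]/n≡m/n p∤1+m) ⟩
      m / p + legendre (m / p)             ≡⟨ legendre-unfold m ⟨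
      legendre m                           ≡⟨ +-identityʳ (legendre m) ⟨
      legendre m + 0                       ∎)
      where open ≡-Reasoning
    ... | yes (divides (suc y) 1+m≡[1+y]*p) with rec y<m
      where
      y<m : y < m
      y<m = s≤s⁻¹ (subst (suc (suc y) ≤_) (sym 1+m≡[1+y]*p) (+-mono-≤ 1<p (m≤m*n y p)))
    ...   | w , v , eq =
      suc w , subst₂ Valuation (sym 1+m≡[1+y]*p) (+-comm w 1) (valuation-* v valuation-p) , (begin
      legendre (suc m)                   ≡⟨ cong legendre 1+m≡[1+y]*p ⟩
      legendre (suc y * p)               ≡⟨ legendre-*p (suc y) ⟩
      suc y + legendre (suc y)           ≡⟨ cong (suc y +_) eq ⟩
      suc y + (legendre y + w)           ≡⟨ rearrange y (legendre y) w ⟩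
      (y + legendre y) + suc w           ≡⟨ cong (λ z → z + legendre z + suc w) m/p≡y ⟨
      (m / p + legendre (m / p)) + suc w ≡⟨ cong (_+ suc w) (legendre-unfold m) ⟨
      legendre m + suc w                 ∎)
      where
      open ≡-Reasoning
      m/p≡y : m / p ≡ y
      m/p≡y = trans (cong (_/ p) (suc-injective (trans 1+m≡[1+y]*p (cong (_+ y * p) (sym (suc-pred p))))))
                    ([r+q*n]/n≡q y (≤-reflexive (suc-pred p)))
      rearrange : ∀ y Ly w → suc y + (Ly + w) ≡ (y + Ly) + suc w
      rearrange = solve-∀

  valuation-! : ∀ m → Valuation (m !) (legendre m)
  valuation-! zero    = valuation-1
  valuation-! (suc m) with legendre-suc m
  ... | w , v , eq =
    subst (Valuation (suc m !)) (trans (+-comm w (legendre m)) (sym eq)) (valuation-* v (valuation-! m))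

  valuation-numBN : ∀ {d k} (N : Fin k → Fin d → ℕ) m →
                    Valuation (proj₁ (BN N m)) (legendreNumBN N m)
  valuation-numBN N m = valuation-prodF _ _ (λ j → valuation-! (weightedSum (N j) m))

  valuation-denBN : ∀ {d k} (N : Fin k → Fin d → ℕ) m →
                    Valuation (proj₂ (BN N m)) (legendreDenBN N m)
  valuation-denBN N m =
    valuation-prodF _ _ (λ j → valuation-prodF _ _ (λ i → valuation-^ (valuation-! (m i)) (N j i)))

  valuation-≥⇒p-integral : ∀ {x y α β} → Valuation x α → Valuation y β → β ≤ α →
                           ∃[ c ] ∃[ e ] (p ∤ e × x * e ≡ c * y)
  valuation-≥⇒p-integral {α = α} {β} (valuation r refl p∤r) (valuation t refl p∤t) β≤α =
    p ^ (α ∸ β) * r , t , p∤t , (begin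
      p ^ α * r * t                   ≡⟨ cong (λ e → p ^ e * r * t) (m∸n+n≡m β≤α) ⟨
      p ^ (α ∸ β + β) * r * t         ≡⟨ cong (λ z → z * r * t) (^-distribˡ-+-* p (α ∸ β) β) ⟩
      p ^ (α ∸ β) * p ^ β * r * t     ≡⟨ rearrange (p ^ (α ∸ β)) (p ^ β) r t ⟩
      p ^ (α ∸ β) * r * (p ^ β * t)   ∎)
    where
    open ≡-Reasoning
    rearrange : ∀ a b r t → a * b * r * t ≡ a * r * (b * t)
    rearrange = solve-∀

lemma10 : (p : ℕ) → Prime p → (d k : ℕ) → 1 ≤ d → 1 ≤ k →
          (N : Fin k → Fin d → ℕ) →
          (s : ℕ) (n u : Fin d → ℕ) → (∀ i → u i < p ^ s) →
          InMulZp p (divF (BN N (λ i → u i + n i * p ^ s)) (BN N u)) (BN N n)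
lemma10 p p-prime d k _ _ N s n u u<p^s =
  valuation-≥⇒p-integral
    (valuation-* (valuation-* (valuation-numBN N M) (valuation-denBN N u)) (valuation-denBN N n))
    (valuation-* (valuation-* (valuation-denBN N M) (valuation-numBN N u)) (valuation-numBN N n))
    (legendre-BN-+*p^ N s n u u<p^s)
  where
  open Legendre p {{prime⇒nonTrivial p-prime}}
  open PAdicValuation p p-prime
  M : Fin d → ℕ
  M i = u i + n i * p ^ s
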